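{- Let $f,g,h,t\geq 1$ be integers. Let $G$ be a $(K_{2,2},K_t)$-free graph and let $Z\subseteq V(G)$ with $|Z|\leq h$. Let $Z_0=\{z_1,z_2,z\}\subseteq Z$ be a $3$-clique such that the set of neighbors of $z$ in $Z$ is $\{z_1,z_2\}$. Let $\mathfrak{p}=(Z_0,\ldots,Z_f;\Gamma_i:i\in[f])$ be a $(Z_0,f+g+2^ht,f)$-phantom in $G$ such that $Z_f\cap Z=Z_0$. Then one of the following holds: (a) there exists a $(z_1,z_2,1,g)$-crystal $\mathfrak{c}$ in $G[Z_f]$ such that $V(\mathfrak{c})$ is anticomplete to $Z\setminus Z_0$; or (b) $G$ has a (not necessarily induced) subgraph isomorphic to $\operatorname{cone}(\operatorname{cone}(T_{f,f}))$.
   Context: Graphs are finite and simple; $G$ is $X$-free if no induced subgraph is isomorphic to $X$; sets of vertices are anticomplete if there are no edges between them; a $c$-clique is a clique of size $c$; $[n]=\{1,\ldots,n\}$. For $Z_0\subseteq V(G)$ and integers $d\geq1$, $r\geq0$, a $(Z_0,d,r)$-phantom in $G$ is a tuple $(Z_0,\ldots,Z_r;\Gamma_i:i\in[r])$ with $Z_0\subseteq\cdots\subseteq Z_r\subseteq V(G)$ such that for every $i\in[r]$, $\Gamma_i$ is a map with domain $E(G[Z_{i-1}])$, where for each edge $e$, $\Gamma_i(e)\subseteq Z_i\setminus Z_{i-1}$, $|\Gamma_i(e)|=d$, both ends of $e$ are complete to $\Gamma_i(e)$, and distinct edges have disjoint images. For adjacent $z_1,z_2$ and integers $f',g'\geq1$,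 a $(z_1,z_2,f',g')$-crystal in a graph $G'$ is a tuple $(S_{1,w},w,S_{2,w}:w\in S)$ with $S$ an $f'$-subset of $V(G')\setminus\{z_1,z_2\}$, the sets $S_{1,w},S_{2,w}$ ($w\in S$) pairwise disjoint $g'$-subsets of $V(G')\setminus(S\cup\{z_1,z_2\})$, and for each $i\in\{1,2\}$, $w\in S$, $x\in S_{i,w}$, the neighbors of $x$ in $\{z_1,z_2,w\}$ are exactly $\{z_i,w\}$; its vertex set is $V(\mathfrak{c})=S\cup\bigcup_{w\in S}(S_{1,w}\cup S_{2,w})$. $T_{d,r}$ is the rooted tree of radius $r$ whose root has degree $d$ (if $r\geq1$) and whose other non-leaf vertices have degree $d+1$. $\operatorname{cone}(F)$ is $F$ plus a new vertex adjacent to all of $F$. -}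

module Defs where

open import Data.Nat using (ℕ; zero; suc; _+_; _*_; _^_; _≤_; _<_; _<ᵇ_)
open import Data.Bool using (Bool)
import Data.Bool as B
open import Data.Fin using (Fin; toℕ)
import Data.Fin as F
open import Data.Fin.Subset using (Subset; _∈_; _∉_; _⊆_; ∣_∣; ⁅_⁆; _∪_; _∩_)
open import Data.List using (List; []; _∷_; length)
open import Data.Product using (Σ; _×_; _,_; ∃; ∃-syntax)
open import Data.Sum using (_⊎_)
open import Relation.Nullary using (¬_; Dec)
open import Relation.Nullary using (¬?)
import Relation.Binary.PropositionalEquality as Eq
open Eq using (_≡_; _≢_)
open import Function.Definitions using (Injective)

record Graph : Set₁ where
  field
    n     : ℕ
    Adj   : Fin n → Fin n → Set
    sym   : ∀ {u v} → Adj u v → Adj v u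
    irr   : ∀ {u} → ¬ Adj u u
    dec   : ∀ u v → Dec (Adj u v)
open Graph public

_⇔_ : Set → Set → Set
A ⇔ B = (A → B) × (B → A)

InducedIn : Graph → Graph → Set
InducedIn X G = Σ (Fin (n X) → Fin (n G)) λ φ →
  Injective _≡_ _≡_ φ × (∀ i j → Adj X i j ⇔ Adj G (φ i) (φ j))

_Free_ : Graph → Graph → Set
G Free X = ¬ InducedIn X G

K : ℕ → Graph
K t = record { n = t ; Adj = λ i j → i ≢ j
             ; sym = λ p q → p (Eq.sym q)
             ; irr = λ p → p Eq.refl
             ; dec = λ i j → ¬? (i F.≟ j) }

side : Fin 4 → Bool
side i = toℕ i <ᵇ 2

K22 : Graph
K22 = record { n = 4 ; Adj = λ i j → side i ≢ side j
             ; sym = λ p q → p (Eq.sym q)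
             ; irr = λ p → p Eq.refl
             ; dec = λ i j → ¬? (side i B.≟ side j) }

-- The sets Z_0 ⊆ ... ⊆ Z_r are given as a sequence Zs : ℕ → Subset n
-- (only indices 0..r matter); Γ (suc k) is the map Γ_{k+1} with domain
-- E(G[Z_k]), an edge {u,v} being given by either ordered pair (u,v).

module _ (G : Graph) where

  SameEdge : Fin (n G) → Fin (n G) → Fin (n G) → Fin (n G) → Set
  SameEdge u v u' v' = (u ≡ u' × v ≡ v') ⊎ (u ≡ v' × v ≡ u')

  record Phantom (Z₀ : Subset (n G)) (d r : ℕ) : Set where
    field
      Zs     : ℕ → Subset (n G)
      Γ      : ℕ → Fin (n G) → Fin (n G) → Subset (n G)
      base   : Zs 0 ≡ Z₀
      chain  : ∀ k → k < r → Zs k ⊆ Zs (suc k)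
      Γ-sym  : ∀ k → k < r → ∀ u v → u ∈ Zs k → v ∈ Zs k → Adj G u v →
               Γ (suc k) u v ≡ Γ (suc k) v u
      Γ-new  : ∀ k → k < r → ∀ u v → u ∈ Zs k → v ∈ Zs k → Adj G u v →
               ∀ x → x ∈ Γ (suc k) u v → x ∈ Zs (suc k) × x ∉ Zs k
      Γ-size : ∀ k → k < r → ∀ u v → u ∈ Zs k → v ∈ Zs k → Adj G u v →
               ∣ Γ (suc k) u v ∣ ≡ d
      Γ-cpl  : ∀ k → k < r → ∀ u v → u ∈ Zs k → v ∈ Zs k → Adj G u v →
               ∀ x → x ∈ Γ (suc k) u v → Adj G u x × Adj G v x
      Γ-disj : ∀ k → k < r → ∀ u v u' v' →
               u ∈ Zs k → v ∈ Zs k → Adj G u v →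
               u' ∈ Zs k → v' ∈ Zs k → Adj G u' v' →
               ∀ x → x ∈ Γ (suc k) u v → x ∈ Γ (suc k) u' v' → SameEdge u v u' v'

-- Crystals in the induced subgraph G[W] (all vertices lie in W; adjacency is
-- that of G).  S₁ w, S₂ w are the sets S_{1,w}, S_{2,w}.

  record Crystal (W : Subset (n G)) (z₁ z₂ : Fin (n G)) (f' g' : ℕ) : Set where
    field
      S      : Subset (n G)
      S₁ S₂  : Fin (n G) → Subset (n G)
      S-size : ∣ S ∣ ≡ f'
      S-W    : S ⊆ W
      S-z₁   : z₁ ∉ S
      S-z₂   : z₂ ∉ S
      size₁  : ∀ w → w ∈ S → ∣ S₁ w ∣ ≡ g'
      size₂  : ∀ w → w ∈ S → ∣ S₂ w ∣ ≡ g'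
      W₁     : ∀ w → w ∈ S → S₁ w ⊆ W
      W₂     : ∀ w → w ∈ S → S₂ w ⊆ W
      out₁   : ∀ w → w ∈ S → ∀ x → x ∈ S₁ w → x ∉ S × x ≢ z₁ × x ≢ z₂
      out₂   : ∀ w → w ∈ S → ∀ x → x ∈ S₂ w → x ∉ S × x ≢ z₁ × x ≢ z₂
      disj₁₁ : ∀ w w' → w ∈ S → w' ∈ S → w ≢ w' → ∀ x → x ∈ S₁ w → x ∉ S₁ w'
      disj₂₂ : ∀ w w' → w ∈ S → w' ∈ S → w ≢ w' → ∀ x → x ∈ S₂ w → x ∉ S₂ w'
      disj₁₂ : ∀ w w' → w ∈ S → w' ∈ S → ∀ x → x ∈ S₁ w → x ∉ S₂ w'
      nbr₁   : ∀ w → w ∈ S → ∀ x → x ∈ S₁ w →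
               Adj G x z₁ × ¬ Adj G x z₂ × Adj G x w
      nbr₂   : ∀ w → w ∈ S → ∀ x → x ∈ S₂ w →
               Adj G x z₂ × ¬ Adj G x z₁ × Adj G x w

  InCrystal : ∀ {W z₁ z₂ f' g'} → Crystal W z₁ z₂ f' g' → Fin (n G) → Set
  InCrystal c v = v ∈ S ⊎ (∃[ w ] (w ∈ S × (v ∈ S₁ w ⊎ v ∈ S₂ w)))
    where open Crystal c

-- Vertices of T_{d,r}: words over Fin d of length ≤ r
-- (root = []); the children of a word l are c ∷ l.  So the root has d
-- children and every other non-leaf has a parent and d children.

data CCT (d r : ℕ) : Set where
  apex₁ apex₂ : CCT d r
  node : (l : List (Fin d)) → length l ≤ r → CCT d r

data CCTAdj {d r : ℕ} : CCT d r → CCT d r → Set where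
  a₁a₂  : CCTAdj apex₁ apex₂
  a₂a₁  : CCTAdj apex₂ apex₁
  a₁n   : ∀ {l p} → CCTAdj apex₁ (node l p)
  na₁   : ∀ {l p} → CCTAdj (node l p) apex₁
  a₂n   : ∀ {l p} → CCTAdj apex₂ (node l p)
  na₂   : ∀ {l p} → CCTAdj (node l p) apex₂
  child : ∀ {l c p q} → CCTAdj (node l p) (node (c ∷ l) q)
  parent : ∀ {l c p q} → CCTAdj (node (c ∷ l) q) (node l p)

HasConeConeTree : Graph → ℕ → ℕ → Set
HasConeConeTree G d r = Σ (CCT d r → Fin (n G)) λ φ →
  Injective _≡_ _≡_ φ × (∀ a b → CCTAdj a b → Adj G (φ a) (φ b))

{-# OPTIONS --safe #-}
-- Call w a candidate at level k if w ∈ Z_k, w is adjacent to z₁ and z₂, and w has no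
-- neighbour in U = Z ∖ Z₀; z is a candidate at level 0. Let w be a candidate at level
-- k < f, let a be one of z₁, z₂ and b the other. As G is K_{2,2}-free, the common
-- neighbours of w and any u ∈ U form a clique, so there are fewer than t of them. Hence
-- at most |U|·t of the d vertices of Γ_{k+1}(aw) have a neighbour in U, and at least
-- f + g remain; each is either private (non-adjacent to b) or shared (adjacent to b, and
-- then a candidate at level k + 1). If for both choices of a there are g private
-- vertices, they form with w a crystal with one centre, anticomplete to U. Otherwise
-- at every candidate one choice of a leaves f shared vertices, and growing from z for f
-- levels embeds T_{f,f}: it is injective because each level is new and the Γ-sets of
-- distinct edges are disjoint. Both z₁ and z₂ are complete to it, which gives
-- cone(cone(T_{f,f})).

module Submission where

open import Defs hiding (sym)
open import Data.Empty using (⊥-elim)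
open import Data.Fin using (Fin; zero; suc)
open import Data.Fin.Patterns using (0F; 1F; 2F; 3F)
open import Data.Fin.Properties as Finₚ using (any?)
open import Data.Fin.Subset using (Subset; inside; outside; _∈_; _∉_; _⊆_; ∣_∣; ⁅_⁆; _∪_; _∩_; ∁; ⊥)
open import Data.Fin.Subset.Properties using (_∈?_; x∈p∪q⁺; x∈p∪q⁻; x∈p∩q⁺; x∈p∩q⁻; x∈∁p⇒x∉p; x∉p⇒x∈∁p; ∉⊥; ⊥⊆; ∣⊥∣≡0; s⊆s; x∈⁅x⁆; x≢y⇒x∉⁅y⁆; x∈⁅y⁆⇒x≡y; ∣⁅x⁆∣≡1; p⊆q⇒∣p∣≤∣q∣; ∣p∣≤∣p∪q∣; ∣q∣≤∣p∪q∣; ∣p∩q∣≤∣p∣; ⊆-reflexive)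
open import Data.List using (List; []; _∷_; length)
open import Data.Nat using (ℕ; zero; suc; _+_; _*_; _^_; _≤_; _<_; z≤n; s≤s; _≤?_; _≤′_; ≤′-refl; ≤′-step)
open import Data.Nat.Properties using (≤-refl; ≤-trans; ≤-reflexive; ≤-antisym; ≤-irrelevant; <⇒≤; ≰⇒>; ≤⇒≤′; suc-injective; n≤1+n; +-suc; +-comm; +-monoʳ-≤; +-mono-≤; +-cancelʳ-≤; *-monoˡ-≤; m^n>0; ≤-<-trans; m<m+n; m≤m+n; anyUpTo?; module ≤-Reasoning)
open import Data.Product using (Σ; ∃-syntax; _×_; _,_; proj₁; proj₂; map; map₁; map₂; swap)
open import Data.Sum using (_⊎_; inj₁; inj₂; [_,_])
open import Data.Vec using ([]; _∷_; tabulate; here; there)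
open import Data.Vec.Properties using (lookup∘tabulate; lookup⇒[]=; []=⇒lookup)
open import Function using (_∘_; id)
open import Function.Definitions using (Injective)
open import Relation.Nullary using (¬_; Dec; yes; no; ¬?)
open import Relation.Nullary.Decidable using (does; dec-true; _×-dec_; map′)
open import Relation.Unary using (Pred; Decidable)
open import Relation.Binary.PropositionalEquality using (_≡_; _≢_; refl; sym; trans; cong; subst)

-- Finite subsets

subsetOf : ∀ {ℓ n} {P : Pred (Fin n) ℓ} → Decidable P → Subset n
subsetOf P? = tabulate (does ∘ P?)

module _ {ℓ n} {P : Pred (Fin n) ℓ} (P? : Decidable P) {x : Fin n} where

  ∈-subsetOf⁺ : P x → x ∈ subsetOf P?
  ∈-subsetOf⁺ px = lookup⇒[]= x _ (trans (lookup∘tabulate (does ∘ P?) x) (dec-true (P? x) px))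

  ∈-subsetOf⁻ : x ∈ subsetOf P? → P x
  ∈-subsetOf⁻ x∈ with P? x | trans (sym (lookup∘tabulate (does ∘ P?) x)) ([]=⇒lookup x∈)
  ... | yes px | _  = px
  ... | no _   | ()

∣p∪q∣≤∣p∣+∣q∣ : ∀ {n} (p q : Subset n) → ∣ p ∪ q ∣ ≤ ∣ p ∣ + ∣ q ∣
∣p∪q∣≤∣p∣+∣q∣ []            []            = z≤n
∣p∪q∣≤∣p∣+∣q∣ (inside  ∷ p) (inside  ∷ q) = s≤s (≤-trans (∣p∪q∣≤∣p∣+∣q∣ p q) (+-monoʳ-≤ ∣ p ∣ (n≤1+n ∣ q ∣)))
∣p∪q∣≤∣p∣+∣q∣ (inside  ∷ p) (outside ∷ q) = s≤s (∣p∪q∣≤∣p∣+∣q∣ p q)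
∣p∪q∣≤∣p∣+∣q∣ (outside ∷ p) (inside  ∷ q) = ≤-trans (s≤s (∣p∪q∣≤∣p∣+∣q∣ p q)) (≤-reflexive (sym (+-suc ∣ p ∣ ∣ q ∣)))
∣p∪q∣≤∣p∣+∣q∣ (outside ∷ p) (outside ∷ q) = ∣p∪q∣≤∣p∣+∣q∣ p q

∣p∣≡∣p∩q∣+∣p∩∁q∣ : ∀ {n} (p q : Subset n) → ∣ p ∣ ≡ ∣ p ∩ q ∣ + ∣ p ∩ ∁ q ∣
∣p∣≡∣p∩q∣+∣p∩∁q∣ []            []            = refl
∣p∣≡∣p∩q∣+∣p∩∁q∣ (inside  ∷ p) (inside  ∷ q) = cong suc (∣p∣≡∣p∩q∣+∣p∩∁q∣ p q)
∣p∣≡∣p∩q∣+∣p∩∁q∣ (inside  ∷ p) (outside ∷ q) = trans (cong suc (∣p∣≡∣p∩q∣+∣p∩∁q∣ p q)) (sym (+-suc ∣ p ∩ q ∣ _))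
∣p∣≡∣p∩q∣+∣p∩∁q∣ (outside ∷ p) (_       ∷ q) = ∣p∣≡∣p∩q∣+∣p∩∁q∣ p q

infix 10 ⋃[_]_

⋃[_]_ : ∀ {m n} → Subset m → (Fin m → Subset n) → Subset n
⋃[ []          ] Q = ⊥
⋃[ inside  ∷ I ] Q = Q zero ∪ ⋃[ I ] (Q ∘ suc)
⋃[ outside ∷ I ] Q = ⋃[ I ] (Q ∘ suc)

∈-⋃⁺ : ∀ {m n} (I : Subset m) (Q : Fin m → Subset n) {i x} → i ∈ I → x ∈ Q i → x ∈ ⋃[ I ] Q
∈-⋃⁺ (inside  ∷ I) Q here       x∈ = x∈p∪q⁺ (inj₁ x∈)
∈-⋃⁺ (inside  ∷ I) Q (there i∈) x∈ = x∈p∪q⁺ (inj₂ (∈-⋃⁺ I (Q ∘ suc) i∈ x∈))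
∈-⋃⁺ (outside ∷ I) Q (there i∈) x∈ = ∈-⋃⁺ I (Q ∘ suc) i∈ x∈

∈-⋃⁻ : ∀ {m n} (I : Subset m) (Q : Fin m → Subset n) {x} → x ∈ ⋃[ I ] Q → ∃[ i ] i ∈ I × x ∈ Q i
∈-⋃⁻ []            Q x∈ = ⊥-elim (∉⊥ x∈)
∈-⋃⁻ (inside  ∷ I) Q x∈ with x∈p∪q⁻ (Q zero) _ x∈
... | inj₁ x∈Q₀ = zero , here , x∈Q₀
... | inj₂ x∈⋃  = map suc (map₁ there) (∈-⋃⁻ I (Q ∘ suc) x∈⋃)
∈-⋃⁻ (outside ∷ I) Q x∈ = map suc (map₁ there) (∈-⋃⁻ I (Q ∘ suc) x∈)

∣⋃∣≤∣I∣*c : ∀ {m n} (I : Subset m) (Q : Fin m → Subset n) {c} → (∀ {i} → i ∈ I → ∣ Q i ∣ ≤ c) → ∣ ⋃[ I ] Q ∣ ≤ ∣ I ∣ * c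
∣⋃∣≤∣I∣*c {n = n} [] Q _ = ≤-reflexive (∣⊥∣≡0 n)
∣⋃∣≤∣I∣*c (inside ∷ I) Q bound =
  ≤-trans (∣p∪q∣≤∣p∣+∣q∣ (Q zero) _) (+-mono-≤ (bound here) (∣⋃∣≤∣I∣*c I (Q ∘ suc) (bound ∘ there)))
∣⋃∣≤∣I∣*c (outside ∷ I) Q bound = ∣⋃∣≤∣I∣*c I (Q ∘ suc) (bound ∘ there)

p∩⋃⊆⋃∩ : ∀ {m n} (p : Subset n) (I : Subset m) (Q : Fin m → Subset n) → p ∩ ⋃[ I ] Q ⊆ ⋃[ I ] (λ i → p ∩ Q i)
p∩⋃⊆⋃∩ p I Q x∈ with x∈p∩q⁻ p _ x∈
... | x∈p , x∈⋃ with ∈-⋃⁻ I Q x∈⋃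
...   | i , i∈I , x∈Qi = ∈-⋃⁺ I _ i∈I (x∈p∩q⁺ (x∈p , x∈Qi))

subset-of-size : ∀ {n} m (p : Subset n) → m ≤ ∣ p ∣ → ∃[ q ] q ⊆ p × ∣ q ∣ ≡ m
subset-of-size {n} zero p _ = ⊥ , ⊥⊆ , ∣⊥∣≡0 n
subset-of-size (suc m) (inside ∷ p) (s≤s m≤∣p∣) with subset-of-size m p m≤∣p∣
... | q , q⊆p , ∣q∣≡m = inside ∷ q , s⊆s q⊆p , cong suc ∣q∣≡m
subset-of-size (suc m) (outside ∷ p) m≤∣p∣ with subset-of-size (suc m) p m≤∣p∣
... | q , q⊆p , ∣q∣≡m = outside ∷ q , s⊆s q⊆p , ∣q∣≡m

fin-injection : ∀ {n} m (p : Subset n) → m ≤ ∣ p ∣ →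
  Σ (Fin m → Fin n) λ φ → Injective _≡_ _≡_ φ × (∀ i → φ i ∈ p)
fin-injection zero p _ = (λ ()) , (λ { {()} }) , (λ ())
fin-injection (suc m) (inside ∷ p) (s≤s m≤∣p∣) with fin-injection m p m≤∣p∣
... | φ , φ-inj , φ∈p = ψ , ψ-inj , ψ∈
  where
  ψ : Fin (suc m) → Fin _
  ψ zero    = zero
  ψ (suc i) = suc (φ i)
  ψ-inj : Injective _≡_ _≡_ ψ
  ψ-inj {zero}  {zero}  _ = refl
  ψ-inj {suc i} {suc j} e = cong suc (φ-inj (Finₚ.suc-injective e))
  ψ∈ : ∀ i → ψ i ∈ inside ∷ p
  ψ∈ zero    = here
  ψ∈ (suc i) = there (φ∈p i)
fin-injection (suc m) (outside ∷ p) m≤∣p∣ with fin-injection (suc m) p m≤∣p∣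
... | φ , φ-inj , φ∈p = suc ∘ φ , φ-inj ∘ Finₚ.suc-injective , there ∘ φ∈p

chain-⊆ : ∀ {n r} {L : ℕ → Subset n} → (∀ k → k < r → L k ⊆ L (suc k)) → ∀ {i j} → i ≤ j → j ≤ r → L i ⊆ L j
chain-⊆ {L = L} step i≤j = go (≤⇒≤′ i≤j)
  where
  go : ∀ {i j} → i ≤′ j → j ≤ _ → L i ⊆ L j
  go ≤′-refl          _    = id
  go (≤′-step i≤′j) j<r = step _ j<r ∘ go i≤′j (<⇒≤ j<r)

n<2^n : ∀ n → n < 2 ^ n
n<2^n zero    = s≤s z≤n
n<2^n (suc n) = ≤-<-trans (n<2^n n) (m<m+n (2 ^ n) (≤-trans (m^n>0 2 n) (m≤m+n (2 ^ n) 0)))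

m+o≤n+p∧p≤o⇒m≤n : ∀ {m n o p} → m + o ≤ n + p → p ≤ o → m ≤ n
m+o≤n+p∧p≤o⇒m≤n {m} {n} {o} m+o≤n+p p≤o = +-cancelʳ-≤ o m n (≤-trans m+o≤n+p (+-monoʳ-≤ n p≤o))

-- Graphs

module Neighbourhood (G : Graph) where

  adj⇒≢ : ∀ {u v} → Adj G u v → u ≢ v
  adj⇒≢ u~v refl = irr G u~v

  N : Fin (n G) → Subset (n G)
  N v = subsetOf (dec G v)

  N[_] : Subset (n G) → Subset (n G)
  N[ U ] = ⋃[ U ] N

  ∈N⁺ : ∀ {v x} → Adj G v x → x ∈ N v
  ∈N⁺ {v} = ∈-subsetOf⁺ (dec G v)

  ∈N⁻ : ∀ {v x} → x ∈ N v → Adj G v x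
  ∈N⁻ {v} = ∈-subsetOf⁻ (dec G v)

  ∈N[]⁺ : ∀ {U u x} → u ∈ U → Adj G u x → x ∈ N[ U ]
  ∈N[]⁺ {U} u∈U u~x = ∈-⋃⁺ U N u∈U (∈N⁺ u~x)

  ∈N[]⁻ : ∀ {U x} → x ∈ N[ U ] → ∃[ u ] u ∈ U × Adj G u x
  ∈N[]⁻ {U} x∈ with ∈-⋃⁻ U N x∈
  ... | u , u∈U , x∈Nu = u , u∈U , ∈N⁻ x∈Nu

  module C4 {p q x y : Fin (n G)} (p≢q : p ≢ q) (x≢y : x ≢ y) (p≁q : ¬ Adj G p q) (x≁y : ¬ Adj G x y)
            (p~x : Adj G p x) (p~y : Adj G p y) (q~x : Adj G q x) (q~y : Adj G q y) where

    φ : Fin 4 → Fin (n G)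
    φ 0F = p
    φ 1F = q
    φ 2F = x
    φ 3F = y

    private
      edge : ∀ {i j} → side i ≢ side j → Adj G (φ i) (φ j) → Adj K22 i j ⇔ Adj G (φ i) (φ j)
      edge sides≢ φi~φj = (λ _ → φi~φj) , (λ _ → sides≢)

      non-edge : ∀ {i j} → side i ≡ side j → ¬ Adj G (φ i) (φ j) → Adj K22 i j ⇔ Adj G (φ i) (φ j)
      non-edge sides≡ φi≁φj = (λ sides≢ → ⊥-elim (sides≢ sides≡)) , (λ φi~φj → ⊥-elim (φi≁φj φi~φj))

    φ-adj : ∀ i j → Adj K22 i j ⇔ Adj G (φ i) (φ j)
    φ-adj 0F 0F = non-edge refl (irr G)
    φ-adj 0F 1F = non-edge refl p≁q
    φ-adj 0F 2F = edge (λ ()) p~x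
    φ-adj 0F 3F = edge (λ ()) p~y
    φ-adj 1F 0F = non-edge refl (p≁q ∘ Graph.sym G)
    φ-adj 1F 1F = non-edge refl (irr G)
    φ-adj 1F 2F = edge (λ ()) q~x
    φ-adj 1F 3F = edge (λ ()) q~y
    φ-adj 2F 0F = edge (λ ()) (Graph.sym G p~x)
    φ-adj 2F 1F = edge (λ ()) (Graph.sym G q~x)
    φ-adj 2F 2F = non-edge refl (irr G)
    φ-adj 2F 3F = non-edge refl x≁y
    φ-adj 3F 0F = edge (λ ()) (Graph.sym G p~y)
    φ-adj 3F 1F = edge (λ ()) (Graph.sym G q~y)
    φ-adj 3F 2F = non-edge refl (x≁y ∘ Graph.sym G)
    φ-adj 3F 3F = non-edge refl (irr G)

    φ-injective : Injective _≡_ _≡_ φ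
    φ-injective {0F} {0F} _ = refl
    φ-injective {0F} {1F} e = ⊥-elim (p≢q e)
    φ-injective {0F} {2F} e = ⊥-elim (adj⇒≢ p~x e)
    φ-injective {0F} {3F} e = ⊥-elim (adj⇒≢ p~y e)
    φ-injective {1F} {0F} e = ⊥-elim (p≢q (sym e))
    φ-injective {1F} {1F} _ = refl
    φ-injective {1F} {2F} e = ⊥-elim (adj⇒≢ q~x e)
    φ-injective {1F} {3F} e = ⊥-elim (adj⇒≢ q~y e)
    φ-injective {2F} {0F} e = ⊥-elim (adj⇒≢ p~x (sym e))
    φ-injective {2F} {1F} e = ⊥-elim (adj⇒≢ q~x (sym e))
    φ-injective {2F} {2F} _ = refl
    φ-injective {2F} {3F} e = ⊥-elim (x≢y e)
    φ-injective {3F} {0F} e = ⊥-elim (adj⇒≢ p~y (sym e))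
    φ-injective {3F} {1F} e = ⊥-elim (adj⇒≢ q~y (sym e))
    φ-injective {3F} {2F} e = ⊥-elim (x≢y (sym e))
    φ-injective {3F} {3F} _ = refl

    induced-K22 : InducedIn K22 G
    induced-K22 = φ , φ-injective , φ-adj

  K22-free⇒common-nbrs-adjacent : G Free K22 → ∀ {u v x y} → u ≢ v → ¬ Adj G u v →
    x ∈ N u ∩ N v → y ∈ N u ∩ N v → x ≢ y → Adj G x y
  K22-free⇒common-nbrs-adjacent K22-free {u} {v} {x} {y} u≢v u≁v x∈ y∈ x≢y with dec G x y
  ... | yes x~y = x~y
  ... | no  x≁y = ⊥-elim (K22-free (C4.induced-K22 u≢v x≢y u≁v x≁y u~x u~y v~x v~y))
    where
    u~x : Adj G u x
    u~x = ∈N⁻ (proj₁ (x∈p∩q⁻ (N u) (N v) x∈))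
    v~x : Adj G v x
    v~x = ∈N⁻ (proj₂ (x∈p∩q⁻ (N u) (N v) x∈))
    u~y : Adj G u y
    u~y = ∈N⁻ (proj₁ (x∈p∩q⁻ (N u) (N v) y∈))
    v~y : Adj G v y
    v~y = ∈N⁻ (proj₂ (x∈p∩q⁻ (N u) (N v) y∈))

  Kt-free⇒clique-size< : ∀ {t} → G Free K t → ∀ {X} →
    (∀ {x y} → x ∈ X → y ∈ X → x ≢ y → Adj G x y) → ∣ X ∣ < t
  Kt-free⇒clique-size< {t} Kt-free {X} clique with t ≤? ∣ X ∣
  ... | no  t≰∣X∣ = ≰⇒> t≰∣X∣
  ... | yes t≤∣X∣ with fin-injection t X t≤∣X∣
  ...   | φ , φ-injective , φ∈X = ⊥-elim (Kt-free (φ , φ-injective , φ-adj))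
    where
    φ-adj : ∀ i j → Adj (K t) i j ⇔ Adj G (φ i) (φ j)
    φ-adj i j = (λ i≢j → clique (φ∈X i) (φ∈X j) (i≢j ∘ φ-injective)) , (λ φi~φj → adj⇒≢ φi~φj ∘ cong φ)

  ∣N∩N[U]∣≤∣U∣*t : G Free K22 → ∀ {t} → G Free K t → ∀ {U w} → w ∉ U → w ∉ N[ U ] →
    ∣ N w ∩ N[ U ] ∣ ≤ ∣ U ∣ * t
  ∣N∩N[U]∣≤∣U∣*t K22-free Kt-free {U} {w} w∉U w∉N[U] =
    ≤-trans (p⊆q⇒∣p∣≤∣q∣ (p∩⋃⊆⋃∩ (N w) U N)) (∣⋃∣≤∣I∣*c U (λ u → N w ∩ N u) common-nbrs-few)
    where
    common-nbrs-few : ∀ {u} → u ∈ U → ∣ N w ∩ N u ∣ ≤ _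
    common-nbrs-few u∈U = <⇒≤ (Kt-free⇒clique-size< Kt-free
      (K22-free⇒common-nbrs-adjacent K22-free (λ { refl → w∉U u∈U }) (λ w~u → w∉N[U] (∈N[]⁺ u∈U (Graph.sym G w~u)))))

module SingletonCrystal (G : Graph) {W : Subset (n G)} {z₁ z₂ w : Fin (n G)} {g : ℕ} {Y₁ Y₂ : Subset (n G)}
  (w∈W : w ∈ W) (w~z₁ : Adj G w z₁) (w~z₂ : Adj G w z₂)
  (Y₁⊆W : Y₁ ⊆ W) (Y₂⊆W : Y₂ ⊆ W) (∣Y₁∣≡g : ∣ Y₁ ∣ ≡ g) (∣Y₂∣≡g : ∣ Y₂ ∣ ≡ g)
  (Y₁∩Y₂≡∅ : ∀ {x} → x ∈ Y₁ → x ∉ Y₂) (z₂∉Y₁ : z₂ ∉ Y₁) (z₁∉Y₂ : z₁ ∉ Y₂)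
  (wing₁ : ∀ {x} → x ∈ Y₁ → Adj G x z₁ × ¬ Adj G x z₂ × Adj G x w)
  (wing₂ : ∀ {x} → x ∈ Y₂ → Adj G x z₂ × ¬ Adj G x z₁ × Adj G x w) where

  open Neighbourhood G using (adj⇒≢)

  private
    wing-outside : ∀ {Y a b} → b ∉ Y → (∀ {x} → x ∈ Y → Adj G x a × ¬ Adj G x b × Adj G x w) →
                   ∀ x → x ∈ Y → x ∉ ⁅ w ⁆ × x ≢ a × x ≢ b
    wing-outside b∉Y wing x x∈Y =
      x≢y⇒x∉⁅y⁆ (adj⇒≢ (proj₂ (proj₂ (wing x∈Y)))) , adj⇒≢ (proj₁ (wing x∈Y)) , λ { refl → b∉Y x∈Y }

    centre : ∀ {v} → v ∈ ⁅ w ⁆ → v ≡ w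
    centre = x∈⁅y⁆⇒x≡y _

  crystal : Crystal G W z₁ z₂ 1 g
  crystal = record
    { S      = ⁅ w ⁆
    ; S₁     = λ _ → Y₁
    ; S₂     = λ _ → Y₂
    ; S-size = ∣⁅x⁆∣≡1 w
    ; S-W    = λ v∈S → subst (_∈ W) (sym (centre v∈S)) w∈W
    ; S-z₁   = λ z₁∈S → adj⇒≢ w~z₁ (sym (centre z₁∈S))
    ; S-z₂   = λ z₂∈S → adj⇒≢ w~z₂ (sym (centre z₂∈S))
    ; size₁  = λ _ _ → ∣Y₁∣≡g
    ; size₂  = λ _ _ → ∣Y₂∣≡g
    ; W₁     = λ _ _ → Y₁⊆W
    ; W₂     = λ _ _ → Y₂⊆W
    ; out₁   = λ _ _ → wing-outside z₂∉Y₁ wing₁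
    ; out₂   = λ _ _ x x∈Y₂ → map₂ swap (wing-outside z₁∉Y₂ wing₂ x x∈Y₂)
    ; disj₁₁ = λ _ _ v∈S v′∈S v≢v′ → ⊥-elim (v≢v′ (trans (centre v∈S) (sym (centre v′∈S))))
    ; disj₂₂ = λ _ _ v∈S v′∈S v≢v′ → ⊥-elim (v≢v′ (trans (centre v∈S) (sym (centre v′∈S))))
    ; disj₁₂ = λ _ _ _ _ _ → Y₁∩Y₂≡∅
    ; nbr₁   = λ _ v∈S _ x∈Y₁ → subst (λ v → Adj G _ z₁ × ¬ Adj G _ z₂ × Adj G _ v) (sym (centre v∈S)) (wing₁ x∈Y₁)
    ; nbr₂   = λ _ v∈S _ x∈Y₂ → subst (λ v → Adj G _ z₂ × ¬ Adj G _ z₁ × Adj G _ v) (sym (centre v∈S)) (wing₂ x∈Y₂)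
    }

  vertices : ∀ {v} → InCrystal G crystal v → v ≡ w ⊎ v ∈ Y₁ ⊎ v ∈ Y₂
  vertices (inj₁ v∈S)                 = inj₁ (centre v∈S)
  vertices (inj₂ (_ , _ , inj₁ v∈Y₁)) = inj₂ (inj₁ v∈Y₁)
  vertices (inj₂ (_ , _ , inj₂ v∈Y₂)) = inj₂ (inj₂ v∈Y₂)

module TreeGrowth (G : Graph) {d r : ℕ}
  (Layer : ℕ → Subset (n G))
  (Good : ℕ → Fin (n G) → Set)
  (Children : ℕ → Fin (n G) → Subset (n G))
  (root : Fin (n G)) (root-good : Good 0 root)
  (layer-chain : ∀ k → k < r → Layer k ⊆ Layer (suc k))
  (good⇒layer : ∀ {k w} → Good k w → w ∈ Layer k)
  (branching : ∀ {k w} → k < r → Good k w → d ≤ ∣ Children k w ∣)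
  (child-good : ∀ {k w} → k < r → Good k w → ∀ {x} → x ∈ Children k w → Good (suc k) x)
  (child-fresh : ∀ {k w} → k < r → Good k w → ∀ {x} → x ∈ Children k w → x ∉ Layer k)
  (child-adj : ∀ {k w} → k < r → Good k w → ∀ {x} → x ∈ Children k w → Adj G w x)
  (parent-unique : ∀ {k w w′ x} → k < r → Good k w → Good k w′ →
                   x ∈ Children k w → x ∈ Children k w′ → w ≡ w′) where

  open Neighbourhood G using (adj⇒≢)

  private
    module _ {k w} (k<r : k < r) (good : Good k w) where
      nth-child : Fin d → Fin (n G)
      nth-child = proj₁ (fin-injection d (Children k w) (branching k<r good))

      nth-child-injective : Injective _≡_ _≡_ nth-child
      nth-child-injective = proj₁ (proj₂ (fin-injection d (Children k w) (branching k<r good)))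

      nth-child∈ : ∀ c → nth-child c ∈ Children k w
      nth-child∈ = proj₂ (proj₂ (fin-injection d (Children k w) (branching k<r good)))

  vertex : (l : List (Fin d)) → length l ≤ r → Fin (n G)
  vertex-good : ∀ l p → Good (length l) (vertex l p)

  vertex []      _   = root
  vertex (c ∷ l) l<r = nth-child l<r (vertex-good l (<⇒≤ l<r)) c

  vertex-good []      _   = root-good
  vertex-good (c ∷ l) l<r = child-good l<r (vertex-good l (<⇒≤ l<r)) (nth-child∈ l<r (vertex-good l (<⇒≤ l<r)) c)

  private
    vertex-child : ∀ c l (l<r : length l < r) → vertex (c ∷ l) l<r ∈ Children (length l) (vertex l (<⇒≤ l<r))
    vertex-child c l l<r = nth-child∈ l<r (vertex-good l (<⇒≤ l<r)) c

    vertex-fresh : ∀ c l p → vertex (c ∷ l) p ∉ Layer (length l)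
    vertex-fresh c l l<r = child-fresh l<r (vertex-good l (<⇒≤ l<r)) (vertex-child c l l<r)

    vertex-level-≤ : ∀ l p l′ p′ → vertex l p ≡ vertex l′ p′ → length l ≤ length l′
    vertex-level-≤ []      _   _  _  _ = z≤n
    vertex-level-≤ (c ∷ l) l<r l′ p′ e with length l′ ≤? length l
    ... | no  l′≰l = ≰⇒> l′≰l
    ... | yes l′≤l = ⊥-elim (vertex-fresh c l l<r
                       (subst (_∈ Layer (length l)) (sym e) (chain-⊆ layer-chain l′≤l (<⇒≤ l<r) (good⇒layer (vertex-good l′ p′)))))

    parent-unique-at : ∀ {k k′ w w′ x} → k ≡ k′ → k < r → Good k w → Good k′ w′ →
                       x ∈ Children k w → x ∈ Children k′ w′ → w ≡ w′
    parent-unique-at refl = parent-unique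

    vertex-injective-level : ∀ l p l′ p′ → length l ≡ length l′ → vertex l p ≡ vertex l′ p′ → l ≡ l′
    vertex-injective-level [] _ [] _ _ _ = refl
    vertex-injective-level (c ∷ l) l<r (c′ ∷ l′) l′<r same-level e
      with refl ← vertex-injective-level l _ l′ _ (suc-injective same-level)
                    (parent-unique-at (suc-injective same-level) l<r (vertex-good l (<⇒≤ l<r)) (vertex-good l′ (<⇒≤ l′<r))
                      (vertex-child c l l<r) (subst (_∈ Children _ _) (sym e) (vertex-child c′ l′ l′<r)))
      with refl ← ≤-irrelevant l<r l′<r
      = cong (_∷ l) (nth-child-injective l<r (vertex-good l (<⇒≤ l<r)) e)

  vertex-injective : ∀ l p l′ p′ → vertex l p ≡ vertex l′ p′ → l ≡ l′
  vertex-injective l p l′ p′ e =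
    vertex-injective-level l p l′ p′ (≤-antisym (vertex-level-≤ l p l′ p′ e) (vertex-level-≤ l′ p′ l p (sym e))) e

  module _ {a₁ a₂} (a₁~a₂ : Adj G a₁ a₂) (apexes : ∀ {k w} → Good k w → Adj G a₁ w × Adj G a₂ w) where

    embed : CCT d r → Fin (n G)
    embed apex₁      = a₁
    embed apex₂      = a₂
    embed (node l p) = vertex l p

    embed-injective : Injective _≡_ _≡_ embed
    embed-injective {apex₁}    {apex₁}      _ = refl
    embed-injective {apex₁}    {apex₂}      e = ⊥-elim (adj⇒≢ a₁~a₂ e)
    embed-injective {apex₁}    {node l p}   e = ⊥-elim (adj⇒≢ (proj₁ (apexes (vertex-good l p))) e)
    embed-injective {apex₂}    {apex₁}      e = ⊥-elim (adj⇒≢ a₁~a₂ (sym e))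
    embed-injective {apex₂}    {apex₂}      _ = refl
    embed-injective {apex₂}    {node l p}   e = ⊥-elim (adj⇒≢ (proj₂ (apexes (vertex-good l p))) e)
    embed-injective {node l p} {apex₁}      e = ⊥-elim (adj⇒≢ (proj₁ (apexes (vertex-good l p))) (sym e))
    embed-injective {node l p} {apex₂}      e = ⊥-elim (adj⇒≢ (proj₂ (apexes (vertex-good l p))) (sym e))
    embed-injective {node l p} {node l′ p′} e with refl ← vertex-injective l p l′ p′ e = cong (node l) (≤-irrelevant p p′)

    embed-adj : ∀ a b → CCTAdj a b → Adj G (embed a) (embed b)
    embed-adj _ _ a₁a₂                = a₁~a₂
    embed-adj _ _ a₂a₁                = Graph.sym G a₁~a₂
    embed-adj _ _ (a₁n {l} {p})       = proj₁ (apexes (vertex-good l p))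
    embed-adj _ _ (na₁ {l} {p})       = Graph.sym G (proj₁ (apexes (vertex-good l p)))
    embed-adj _ _ (a₂n {l} {p})       = proj₂ (apexes (vertex-good l p))
    embed-adj _ _ (na₂ {l} {p})       = Graph.sym G (proj₂ (apexes (vertex-good l p)))
    embed-adj _ _ (child {l} {c} {p} {q}) with refl ← ≤-irrelevant p (<⇒≤ q) = child-adj q (vertex-good l p) (vertex-child c l q)
    embed-adj _ _ (parent {l} {c} {p} {q}) with refl ← ≤-irrelevant p (<⇒≤ q) = Graph.sym G (child-adj q (vertex-good l p) (vertex-child c l q))

    coneConeTree : HasConeConeTree G d r
    coneConeTree = embed , embed-injective , embed-adj

-- The dichotomy

module Dichotomy {f g t d : ℕ} {G : Graph} (K22-free : G Free K22) (Kt-free : G Free K t)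
  {Z₀ Z : Subset (n G)} {z₁ z₂ z : Fin (n G)}
  (z₁∈Z₀ : z₁ ∈ Z₀) (z₂∈Z₀ : z₂ ∈ Z₀) (z∈Z₀ : z ∈ Z₀)
  (z₁~z₂ : Adj G z₁ z₂) (z₁~z : Adj G z₁ z) (z₂~z : Adj G z₂ z)
  (N[z]∩Z⊆Z₀ : ∀ {v} → v ∈ Z → Adj G z v → v ∈ Z₀)
  (𝔭 : Phantom G Z₀ d f) (Zf∩Z⊆Z₀ : Phantom.Zs 𝔭 f ∩ Z ⊆ Z₀)
  (d-large : f + g + ∣ Z ∩ ∁ Z₀ ∣ * t ≤ d) where

  open Phantom 𝔭
  open Neighbourhood G

  U : Subset (n G)
  U = Z ∩ ∁ Z₀

  Zs-mono : ∀ {i j} → i ≤ j → j ≤ f → Zs i ⊆ Zs j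
  Zs-mono = chain-⊆ chain

  Z₀⊆Zs : ∀ {k} → k ≤ f → Z₀ ⊆ Zs k
  Z₀⊆Zs k≤f x∈Z₀ = Zs-mono z≤n k≤f (subst (_ ∈_) (sym base) x∈Z₀)

  Zs∩U≡∅ : ∀ {k w} → k ≤ f → w ∈ Zs k → w ∉ U
  Zs∩U≡∅ k≤f w∈Zs w∈U with x∈p∩q⁻ Z (∁ Z₀) w∈U
  ... | w∈Z , w∈∁Z₀ = x∈∁p⇒x∉p w∈∁Z₀ (Zf∩Z⊆Z₀ (x∈p∩q⁺ (Zs-mono k≤f ≤-refl w∈Zs , w∈Z)))

  touches-U : ∀ {u v} → u ∈ Z → u ∉ Z₀ → Adj G u v → v ∈ N[ U ]
  touches-U u∈Z u∉Z₀ = ∈N[]⁺ (x∈p∩q⁺ (u∈Z , x∉p⇒x∈∁p u∉Z₀))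

  record Candidate (k : ℕ) (w : Fin (n G)) : Set where
    constructor candidate
    field
      layer : w ∈ Zs k
      z₁~   : Adj G z₁ w
      z₂~   : Adj G z₂ w
      clean : w ∉ N[ U ]
  open Candidate

  candidate? : ∀ k w → Dec (Candidate k w)
  candidate? k w = map′ (λ (l , a₁ , a₂ , c) → candidate l a₁ a₂ c) (λ cw → layer cw , z₁~ cw , z₂~ cw , clean cw)
    (w ∈? Zs k ×-dec dec G z₁ w ×-dec dec G z₂ w ×-dec ¬? (w ∈? N[ U ]))

  root : Candidate 0 z
  root = candidate (subst (z ∈_) (sym base) z∈Z₀) z₁~z z₂~z z-clean
    where
    z-clean : z ∉ N[ U ]
    z-clean z∈N[U] with ∈N[]⁻ z∈N[U]
    ... | u , u∈U , u~z with x∈p∩q⁻ Z (∁ Z₀) u∈U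
    ...   | u∈Z , u∈∁Z₀ = x∈∁p⇒x∉p u∈∁Z₀ (N[z]∩Z⊆Z₀ u∈Z (Graph.sym G u~z))

  Apex : Fin (n G) → Set
  Apex a = a ≡ z₁ ⊎ a ≡ z₂

  apex∈Z₀ : ∀ {a} → Apex a → a ∈ Z₀
  apex∈Z₀ (inj₁ refl) = z₁∈Z₀
  apex∈Z₀ (inj₂ refl) = z₂∈Z₀

  apex~ : ∀ {a k w} → Apex a → Candidate k w → Adj G a w
  apex~ (inj₁ refl) = z₁~
  apex~ (inj₂ refl) = z₂~

  module _ {k a w} (k<f : k < f) (apex : Apex a) (cw : Candidate k w) where

    private
      a∈Zs : a ∈ Zs k
      a∈Zs = Z₀⊆Zs (<⇒≤ k<f) (apex∈Z₀ apex)

    Γ-fresh : ∀ {x} → x ∈ Γ (suc k) a w → x ∈ Zs (suc k) × x ∉ Zs k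
    Γ-fresh = Γ-new k k<f a w a∈Zs (layer cw) (apex~ apex cw) _

    Γ-adj : ∀ {x} → x ∈ Γ (suc k) a w → Adj G a x × Adj G w x
    Γ-adj = Γ-cpl k k<f a w a∈Zs (layer cw) (apex~ apex cw) _

    ∣Γ∣≡d : ∣ Γ (suc k) a w ∣ ≡ d
    ∣Γ∣≡d = Γ-size k k<f a w a∈Zs (layer cw) (apex~ apex cw)

    ∣Γ∩N[U]∣≤∣U∣*t : ∣ Γ (suc k) a w ∩ N[ U ] ∣ ≤ ∣ U ∣ * t
    ∣Γ∩N[U]∣≤∣U∣*t = ≤-trans (p⊆q⇒∣p∣≤∣q∣ Γ∩N[U]⊆N∩N[U])
      (∣N∩N[U]∣≤∣U∣*t K22-free Kt-free (Zs∩U≡∅ (<⇒≤ k<f) (layer cw)) (clean cw))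
      where
      Γ∩N[U]⊆N∩N[U] : Γ (suc k) a w ∩ N[ U ] ⊆ N w ∩ N[ U ]
      Γ∩N[U]⊆N∩N[U] x∈ with x∈p∩q⁻ (Γ (suc k) a w) _ x∈
      ... | x∈Γ , x∈N[U] = x∈p∩q⁺ (∈N⁺ (proj₂ (Γ-adj x∈Γ)) , x∈N[U])

  Γ-centre-unique : ∀ {k a a′ w w′ x} → k < f → Apex a → Apex a′ → Candidate k w → Candidate k w′ →
    x ∈ Γ (suc k) a w → x ∈ Γ (suc k) a′ w′ → a ≡ a′ × w ≡ w′
  Γ-centre-unique {k} {a} {a′} {w} {w′} {x} k<f apex apex′ cw cw′ x∈Γ x∈Γ′
    with Γ-disj k k<f a w a′ w′ (Z₀⊆Zs (<⇒≤ k<f) (apex∈Z₀ apex)) (layer cw) (apex~ apex cw)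
                                (Z₀⊆Zs (<⇒≤ k<f) (apex∈Z₀ apex′)) (layer cw′) (apex~ apex′ cw′) x x∈Γ x∈Γ′
  ... | inj₁ same          = same
  ... | inj₂ (_ , w≡a′) = ⊥-elim (adj⇒≢ (apex~ apex′ cw) (sym w≡a′))

  module Side {a b : Fin (n G)} (apex : Apex a)
    (common : ∀ {x} → Adj G a x → Adj G b x → Adj G z₁ x × Adj G z₂ x) (k : ℕ) (w : Fin (n G)) where

    Clean Private Shared : Subset (n G)
    Clean   = Γ (suc k) a w ∩ ∁ N[ U ]
    Private = Clean ∩ ∁ (N b)
    Shared  = Clean ∩ N b

    private
      ∈Clean⁻ : ∀ {x} → x ∈ Clean → x ∈ Γ (suc k) a w × x ∉ N[ U ]
      ∈Clean⁻ x∈ with x∈p∩q⁻ (Γ (suc k) a w) _ x∈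
      ... | x∈Γ , x∈∁N[U] = x∈Γ , x∈∁p⇒x∉p x∈∁N[U]

    Private⊆Γ : ∀ {x} → x ∈ Private → x ∈ Γ (suc k) a w
    Private⊆Γ = proj₁ ∘ ∈Clean⁻ ∘ proj₁ ∘ x∈p∩q⁻ Clean _

    Private-clean : ∀ {x} → x ∈ Private → x ∉ N[ U ]
    Private-clean = proj₂ ∘ ∈Clean⁻ ∘ proj₁ ∘ x∈p∩q⁻ Clean _

    Shared⊆Γ : ∀ {x} → x ∈ Shared → x ∈ Γ (suc k) a w
    Shared⊆Γ = proj₁ ∘ ∈Clean⁻ ∘ proj₁ ∘ x∈p∩q⁻ Clean _

    module _ (k<f : k < f) (cw : Candidate k w) where

      Private-wing : ∀ {x} → x ∈ Private → Adj G x a × ¬ Adj G x b × Adj G x w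
      Private-wing x∈ =
        Graph.sym G (proj₁ (Γ-adj k<f apex cw (Private⊆Γ x∈))) ,
        (λ x~b → x∈∁p⇒x∉p (proj₂ (x∈p∩q⁻ Clean _ x∈)) (∈N⁺ (Graph.sym G x~b))) ,
        Graph.sym G (proj₂ (Γ-adj k<f apex cw (Private⊆Γ x∈)))

      Shared-candidate : ∀ {x} → x ∈ Shared → Candidate (suc k) x
      Shared-candidate x∈ with x∈p∩q⁻ Clean _ x∈
      ... | x∈Clean , x∈Nb with ∈Clean⁻ x∈Clean
      ...   | x∈Γ , x-clean with common (proj₁ (Γ-adj k<f apex cw x∈Γ)) (∈N⁻ x∈Nb)
      ...     | z₁~x , z₂~x = candidate (proj₁ (Γ-fresh k<f apex cw x∈Γ)) z₁~x z₂~x x-clean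

      Shared+Private : f + g ≤ ∣ Shared ∣ + ∣ Private ∣
      Shared+Private = m+o≤n+p∧p≤o⇒m≤n count (∣Γ∩N[U]∣≤∣U∣*t k<f apex cw)
        where
        open ≤-Reasoning
        count : f + g + ∣ U ∣ * t ≤ ∣ Shared ∣ + ∣ Private ∣ + ∣ Γ (suc k) a w ∩ N[ U ] ∣
        count = begin
          f + g + ∣ U ∣ * t                                          ≤⟨ d-large ⟩
          d                                                          ≡⟨ ∣Γ∣≡d k<f apex cw ⟨
          ∣ Γ (suc k) a w ∣                                           ≡⟨ ∣p∣≡∣p∩q∣+∣p∩∁q∣ (Γ (suc k) a w) N[ U ] ⟩
          ∣ Γ (suc k) a w ∩ N[ U ] ∣ + ∣ Clean ∣                     ≡⟨ cong (∣ Γ (suc k) a w ∩ N[ U ] ∣ +_) (∣p∣≡∣p∩q∣+∣p∩∁q∣ Clean (N b)) ⟩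
          ∣ Γ (suc k) a w ∩ N[ U ] ∣ + (∣ Shared ∣ + ∣ Private ∣)    ≡⟨ +-comm _ (∣ Shared ∣ + ∣ Private ∣) ⟩
          ∣ Shared ∣ + ∣ Private ∣ + ∣ Γ (suc k) a w ∩ N[ U ] ∣      ∎

      Private-small⇒Shared-large : ∣ Private ∣ < g → f ≤ ∣ Shared ∣
      Private-small⇒Shared-large P<g = m+o≤n+p∧p≤o⇒m≤n Shared+Private (<⇒≤ P<g)

  module S₁ = Side (inj₁ refl) _,_
  module S₂ = Side (inj₂ refl) (λ z₂~x z₁~x → z₁~x , z₂~x)

  Children : ℕ → Fin (n G) → Subset (n G)
  Children k w = S₁.Shared k w ∪ S₂.Shared k w

  Rich : ℕ → Fin (n G) → Set
  Rich k w = g ≤ ∣ S₁.Private k w ∣ × g ≤ ∣ S₂.Private k w ∣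

  rich? : ∀ k w → Dec (Rich k w)
  rich? k w = g ≤? ∣ S₁.Private k w ∣ ×-dec g ≤? ∣ S₂.Private k w ∣

  module _ {k w} (k<f : k < f) (cw : Candidate k w) where

    branching : ¬ Rich k w → f ≤ ∣ Children k w ∣
    branching not-rich with g ≤? ∣ S₁.Private k w ∣ | g ≤? ∣ S₂.Private k w ∣
    ... | yes g≤P₁ | yes g≤P₂ = ⊥-elim (not-rich (g≤P₁ , g≤P₂))
    ... | no  g≰P₁ | _        = ≤-trans (S₁.Private-small⇒Shared-large k w k<f cw (≰⇒> g≰P₁)) (∣p∣≤∣p∪q∣ (S₁.Shared k w) (S₂.Shared k w))
    ... | _        | no  g≰P₂ = ≤-trans (S₂.Private-small⇒Shared-large k w k<f cw (≰⇒> g≰P₂)) (∣q∣≤∣p∪q∣ (S₁.Shared k w) (S₂.Shared k w))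

    child-Γ : ∀ {x} → x ∈ Children k w → ∃[ a ] Apex a × x ∈ Γ (suc k) a w
    child-Γ x∈ = [ (λ x∈S₁ → z₁ , inj₁ refl , S₁.Shared⊆Γ k w x∈S₁) , (λ x∈S₂ → z₂ , inj₂ refl , S₂.Shared⊆Γ k w x∈S₂) ]
                 (x∈p∪q⁻ (S₁.Shared k w) _ x∈)

    child-candidate : ∀ {x} → x ∈ Children k w → Candidate (suc k) x
    child-candidate x∈ = [ S₁.Shared-candidate k w k<f cw , S₂.Shared-candidate k w k<f cw ] (x∈p∪q⁻ (S₁.Shared k w) _ x∈)

    child-fresh : ∀ {x} → x ∈ Children k w → x ∉ Zs k
    child-fresh x∈ with child-Γ x∈
    ... | a , apex , x∈Γ = proj₂ (Γ-fresh k<f apex cw x∈Γ)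

    child-adj : ∀ {x} → x ∈ Children k w → Adj G w x
    child-adj x∈ with child-Γ x∈
    ... | a , apex , x∈Γ = proj₂ (Γ-adj k<f apex cw x∈Γ)

  parent-unique : ∀ {k w w′ x} → k < f → Candidate k w → Candidate k w′ →
    x ∈ Children k w → x ∈ Children k w′ → w ≡ w′
  parent-unique k<f cw cw′ x∈ x∈′ with child-Γ k<f cw x∈ | child-Γ k<f cw′ x∈′
  ... | _ , apex , x∈Γ | _ , apex′ , x∈Γ′ = proj₂ (Γ-centre-unique k<f apex apex′ cw cw′ x∈Γ x∈Γ′)

  crystal-at : ∀ {k w} → k < f → Candidate k w → Rich k w →
    Σ (Crystal G (Zs f) z₁ z₂ 1 g) λ 𝔠 → ∀ v u → InCrystal G 𝔠 v → u ∈ Z → u ∉ Z₀ → ¬ Adj G u v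
  crystal-at {k} {w} k<f cw (g≤P₁ , g≤P₂)
    with Y₁ , Y₁⊆P₁ , ∣Y₁∣≡g ← subset-of-size g (S₁.Private k w) g≤P₁
       | Y₂ , Y₂⊆P₂ , ∣Y₂∣≡g ← subset-of-size g (S₂.Private k w) g≤P₂
    = C.crystal , anticomplete
    where
    fresh₁ : ∀ {x} → x ∈ Y₁ → x ∈ Zs (suc k) × x ∉ Zs k
    fresh₁ = Γ-fresh k<f (inj₁ refl) cw ∘ S₁.Private⊆Γ k w ∘ Y₁⊆P₁
    fresh₂ : ∀ {x} → x ∈ Y₂ → x ∈ Zs (suc k) × x ∉ Zs k
    fresh₂ = Γ-fresh k<f (inj₂ refl) cw ∘ S₂.Private⊆Γ k w ∘ Y₂⊆P₂

    module C = SingletonCrystal G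
      (Zs-mono (<⇒≤ k<f) ≤-refl (layer cw)) (Graph.sym G (z₁~ cw)) (Graph.sym G (z₂~ cw))
      (Zs-mono k<f ≤-refl ∘ proj₁ ∘ fresh₁) (Zs-mono k<f ≤-refl ∘ proj₁ ∘ fresh₂) ∣Y₁∣≡g ∣Y₂∣≡g
      (λ x∈Y₁ x∈Y₂ → adj⇒≢ z₁~z₂ (proj₁ (Γ-centre-unique k<f (inj₁ refl) (inj₂ refl) cw cw
                        (S₁.Private⊆Γ k w (Y₁⊆P₁ x∈Y₁)) (S₂.Private⊆Γ k w (Y₂⊆P₂ x∈Y₂)))))
      (λ z₂∈Y₁ → proj₂ (fresh₁ z₂∈Y₁) (Z₀⊆Zs (<⇒≤ k<f) z₂∈Z₀))
      (λ z₁∈Y₂ → proj₂ (fresh₂ z₁∈Y₂) (Z₀⊆Zs (<⇒≤ k<f) z₁∈Z₀))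
      (S₁.Private-wing k w k<f cw ∘ Y₁⊆P₁) (S₂.Private-wing k w k<f cw ∘ Y₂⊆P₂)

    crystal-clean : ∀ {v} → v ≡ w ⊎ v ∈ Y₁ ⊎ v ∈ Y₂ → v ∉ N[ U ]
    crystal-clean (inj₁ refl)         = clean cw
    crystal-clean (inj₂ (inj₁ v∈Y₁)) = S₁.Private-clean k w (Y₁⊆P₁ v∈Y₁)
    crystal-clean (inj₂ (inj₂ v∈Y₂)) = S₂.Private-clean k w (Y₂⊆P₂ v∈Y₂)

    anticomplete : ∀ v u → InCrystal G C.crystal v → u ∈ Z → u ∉ Z₀ → ¬ Adj G u v
    anticomplete v u v∈𝔠 u∈Z u∉Z₀ u~v = crystal-clean (C.vertices v∈𝔠) (touches-U u∈Z u∉Z₀ u~v)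

  crystal-or-coneConeTree :
    (Σ (Crystal G (Zs f) z₁ z₂ 1 g) λ 𝔠 → ∀ v u → InCrystal G 𝔠 v → u ∈ Z → u ∉ Z₀ → ¬ Adj G u v)
    ⊎ HasConeConeTree G f f
  crystal-or-coneConeTree with anyUpTo? (λ k → any? (λ w → candidate? k w ×-dec rich? k w)) f
  ... | yes (k , k<f , w , cw , rich) = inj₁ (crystal-at k<f cw rich)
  ... | no no-rich = inj₂ (Tree.coneConeTree z₁~z₂ (λ cw → z₁~ cw , z₂~ cw))
    where
    module Tree = TreeGrowth G Zs Candidate Children z root chain layer
      (λ k<f cw → branching k<f cw (λ rich → no-rich (_ , k<f , _ , cw , rich)))
      child-candidate child-fresh child-adj parent-unique

theorem3p2 : (f g h t : ℕ) → 1 ≤ f → 1 ≤ g → 1 ≤ h → 1 ≤ t →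
    (G : Graph) → G Free K22 → G Free K t →
    (Z : Subset (n G)) → ∣ Z ∣ ≤ h →
    (z₁ z₂ z : Fin (n G)) →
    Adj G z₁ z₂ → Adj G z₁ z → Adj G z₂ z →
    ⁅ z₁ ⁆ ∪ ⁅ z₂ ⁆ ∪ ⁅ z ⁆ ⊆ Z →
    (∀ v → v ∈ Z → (Adj G z v ⇔ (v ≡ z₁ ⊎ v ≡ z₂))) →
    (𝔭 : Phantom G (⁅ z₁ ⁆ ∪ ⁅ z₂ ⁆ ∪ ⁅ z ⁆) (f + g + 2 ^ h * t) f) →
    Phantom.Zs 𝔭 f ∩ Z ≡ ⁅ z₁ ⁆ ∪ ⁅ z₂ ⁆ ∪ ⁅ z ⁆ →
    (Σ (Crystal G (Phantom.Zs 𝔭 f) z₁ z₂ 1 g) λ 𝔠 →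
       ∀ v u → InCrystal G 𝔠 v → u ∈ Z → u ∉ (⁅ z₁ ⁆ ∪ ⁅ z₂ ⁆ ∪ ⁅ z ⁆) → ¬ Adj G u v)
    ⊎ HasConeConeTree G f f
theorem3p2 f g h t _ _ _ _ G K22-free Kt-free Z ∣Z∣≤h z₁ z₂ z z₁~z₂ z₁~z z₂~z _ N[z]∩Z 𝔭 Zf∩Z≡Z₀ =
  Dichotomy.crystal-or-coneConeTree K22-free Kt-free z₁∈Z₀ z₂∈Z₀ z∈Z₀ z₁~z₂ z₁~z z₂~z
    N[z]∩Z⊆Z₀ 𝔭 (⊆-reflexive Zf∩Z≡Z₀) d-large
  where
  z₁∈Z₀ : z₁ ∈ ⁅ z₁ ⁆ ∪ ⁅ z₂ ⁆ ∪ ⁅ z ⁆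
  z₁∈Z₀ = x∈p∪q⁺ (inj₁ (x∈⁅x⁆ z₁))
  z₂∈Z₀ : z₂ ∈ ⁅ z₁ ⁆ ∪ ⁅ z₂ ⁆ ∪ ⁅ z ⁆
  z₂∈Z₀ = x∈p∪q⁺ (inj₂ (x∈p∪q⁺ (inj₁ (x∈⁅x⁆ z₂))))
  z∈Z₀ : z ∈ ⁅ z₁ ⁆ ∪ ⁅ z₂ ⁆ ∪ ⁅ z ⁆
  z∈Z₀ = x∈p∪q⁺ (inj₂ (x∈p∪q⁺ (inj₂ (x∈⁅x⁆ z))))

  N[z]∩Z⊆Z₀ : ∀ {v} → v ∈ Z → Adj G z v → v ∈ ⁅ z₁ ⁆ ∪ ⁅ z₂ ⁆ ∪ ⁅ z ⁆
  N[z]∩Z⊆Z₀ {v} v∈Z z~v = [ (λ { refl → z₁∈Z₀ }) , (λ { refl → z₂∈Z₀ }) ] (proj₁ (N[z]∩Z v v∈Z) z~v)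

  -- Only |Z ∖ Z₀|·t vertices of a Γ-set can have a neighbour in Z ∖ Z₀; 2 ^ h * t is generous.
  d-large : f + g + ∣ Z ∩ ∁ (⁅ z₁ ⁆ ∪ ⁅ z₂ ⁆ ∪ ⁅ z ⁆) ∣ * t ≤ f + g + 2 ^ h * t
  d-large = +-monoʳ-≤ (f + g) (*-monoˡ-≤ t (≤-trans (∣p∩q∣≤∣p∣ Z _) (≤-trans ∣Z∣≤h (<⇒≤ (n<2^n h)))))
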